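{- Let $G\in\mathcal{G}_n$. If $v$ is a vertex of $G$ with no triangle in its neighbourhood (i.e. $v$ lies in no triangle of $G$), then there is a graph $G'$ adjacent to $G$ in $\mathcal{G}_n^*$ which has a triangle containing $v$.
   Context: $\mathcal{G}_n$ is the set of simple 3-regular graphs on vertex set $[n]$, $n\ge 4$ even. A make move ${\tt make}(yxvwz)$ applies to $G=(V,E)$ when $y,x,v,w,z$ are distinct, $yx,xv,vw,wz\in E$ and $xw,yz\notin E$, and replaces $E$ by $(E\setminus\{xy,wz\})\cup\{xw,yz\}$. A break move ${\tt break}(vxw,yz)$ applies when $vxwv$ is a triangle, $yz\in E$, $\{y,z\}\cap\{v,x,w\}=\emptyset$ and $xy,wz\notin E$, and replaces $E$ by $(E\setminus\{xw,yz\})\cup\{xy,wz\}$. $\mathcal{G}_n^*$ is the graph on vertex set $\mathcal{G}_n$ with $G,G'$ adjacent iff a make or break move takes $G$ to $G'$. -}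

module Defs where

open import Data.Nat using (ℕ; _≤_)
open import Data.Nat.Divisibility using (_∣_)
open import Data.Bool using (Bool; true; false; _∧_; _∨_; not; T)
open import Data.Fin using (Fin; _≟_)
open import Data.List using (List; length; filterᵇ; allFin)
open import Data.Product using (Σ; ∃; _×_; _,_)
open import Data.Sum using (_⊎_)
open import Relation.Nullary using (¬_)
open import Relation.Nullary.Decidable using (⌊_⌋)
open import Relation.Binary.PropositionalEquality using (_≡_; _≢_)

record Cubic (n : ℕ) : Set where
  field
    adj    : Fin n → Fin n → Bool
    sym    : ∀ a b → adj a b ≡ adj b a
    irrefl : ∀ a → adj a a ≡ false
    deg3   : ∀ a → length (filterᵇ (adj a) (allFin n)) ≡ 3
open Cubic public

_==_ : ∀ {n} → Fin n → Fin n → Bool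
a == b = ⌊ a ≟ b ⌋

samePair : ∀ {n} → Fin n → Fin n → Fin n → Fin n → Bool
samePair a b x y = ((a == x) ∧ (b == y)) ∨ ((a == y) ∧ (b == x))

-- edge set of the result of removing edges {p,q},{r,s} and adding {t,u},{k,l}
switched : ∀ {n} → Cubic n → (p q r s t u k l : Fin n) → Fin n → Fin n → Bool
switched G p q r s t u k l a b =
  (adj G a b ∧ not (samePair a b p q) ∧ not (samePair a b r s))
  ∨ samePair a b t u ∨ samePair a b k l

Edge : ∀ {n} → Cubic n → Fin n → Fin n → Set
Edge G a b = adj G a b ≡ true

NonEdge : ∀ {n} → Cubic n → Fin n → Fin n → Set
NonEdge G a b = adj G a b ≡ false

Distinct5 : ∀ {n} → Fin n → Fin n → Fin n → Fin n → Fin n → Set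
Distinct5 y x v w z =
  y ≢ x × y ≢ v × y ≢ w × y ≢ z × x ≢ v × x ≢ w × x ≢ z ×
  v ≢ w × v ≢ z × w ≢ z

Make : ∀ {n} → Cubic n → Cubic n → (y x v w z : Fin n) → Set
Make G G' y x v w z =
  Distinct5 y x v w z ×
  Edge G y x × Edge G x v × Edge G v w × Edge G w z ×
  NonEdge G x w × NonEdge G y z ×
  (∀ a b → adj G' a b ≡ switched G x y w z x w y z a b)

Break : ∀ {n} → Cubic n → Cubic n → (v x w y z : Fin n) → Set
Break G G' v x w y z =
  v ≢ x × v ≢ w × x ≢ w ×
  Edge G v x × Edge G x w × Edge G w v ×
  Edge G y z ×
  y ≢ v × y ≢ x × y ≢ w × z ≢ v × z ≢ x × z ≢ w ×
  NonEdge G x y × NonEdge G w z ×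
  (∀ a b → adj G' a b ≡ switched G x w y z x y w z a b)

MoveAdj : ∀ {n} → Cubic n → Cubic n → Set
MoveAdj G G' =
  (∃ λ y → ∃ λ x → ∃ λ v → ∃ λ w → ∃ λ z → Make G G' y x v w z)
  ⊎ (∃ λ v → ∃ λ x → ∃ λ w → ∃ λ y → ∃ λ z → Break G G' v x w y z)

InTriangle : ∀ {n} → Cubic n → Fin n → Set
InTriangle G v = ∃ λ a → ∃ λ b → Edge G v a × Edge G a b × Edge G b v

-- Let a, b, c be the neighbours of v; they are pairwise non-adjacent. For two
-- of them, x and w, an "outer" neighbour y ≠ v of x and an outer neighbour
-- z ≠ v of w with y ≠ z and yz ∉ E make make(yxvwz) applicable, and it
-- creates the triangle v x w. Such a choice always exists:
--   * if two of a, b, c share an outer neighbour s, then either s is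
--     non-adjacent to an outer neighbour of one of them, or s already has its
--     three neighbours and is non-adjacent to a suitable outer neighbour of
--     the third vertex;
--   * otherwise an outer neighbour of a cannot be adjacent to a and to the
--     (then distinct) outer neighbours b₁, b₂ of b and c₁ of c.
-- Both arguments only use that a vertex has at most three neighbours.
module Submission where

open import Defs
open import Data.Nat using (ℕ; suc; _+_; _≤_; z≤n; s≤s)
open import Data.Nat.Properties using (+-cancelʳ-≡; +-commutativeSemigroup)
open import Algebra.Properties.CommutativeSemigroup +-commutativeSemigroup using (interchange)
open import Data.Nat.Divisibility using (_∣_)
open import Data.Bool using (Bool; true; false; _∧_; _∨_; not; T)
open import Data.Bool.Properties using (∧-identityʳ; ∨-identityʳ; ∨-zeroʳ; ∧-comm; ∨-comm; T-≡)
open import Data.Fin using (Fin; _≟_)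
open import Data.List using (List; []; _∷_; length; filterᵇ; allFin)
open import Data.List.Properties using (filter-≐; length-removeAt′)
open import Data.List.Membership.Propositional using (_∈_; _─_)
open import Data.List.Membership.Propositional.Properties using (∈-filter⁺; ∈-filter⁻; ∈-allFin)
open import Data.List.Relation.Binary.Subset.Propositional using (_⊆_)
open import Data.List.Relation.Unary.Any using (here; there; index)
open import Data.List.Relation.Unary.All as All using (All; []; _∷_)
open import Data.List.Relation.Unary.AllPairs using ([]; _∷_)
open import Data.List.Relation.Unary.Unique.Propositional using (Unique)
open import Data.List.Relation.Unary.Unique.Propositional.Properties using (filter⁺; allFin⁺)
open import Data.Product using (Σ; _×_; _,_; proj₂)
open import Data.Sum using (_⊎_; inj₁; inj₂)
open import Data.Empty using (⊥; ⊥-elim)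
open import Function using (_∘_; Equivalence)
open import Relation.Nullary using (¬_; Dec; yes; no)
open import Relation.Nullary.Decidable using (T?; isYes≗does; dec-true; dec-false)
open import Relation.Binary.PropositionalEquality
  using (_≡_; _≢_; refl; trans; cong; cong₂; subst; ≢-sym; module ≡-Reasoning)
import Relation.Binary.PropositionalEquality as ≡

==-≡ : ∀ {n} {a b : Fin n} → a ≡ b → (a == b) ≡ true
==-≡ {a = a} {b} a≡b = trans (isYes≗does (a ≟ b)) (dec-true (a ≟ b) a≡b)

==-≢ : ∀ {n} {a b : Fin n} → a ≢ b → (a == b) ≡ false
==-≢ {a = a} {b} a≢b = trans (isYes≗does (a ≟ b)) (dec-false (a ≟ b) a≢b)

count : ∀ {A : Set} → (A → Bool) → List A → ℕ
count f xs = length (filterᵇ f xs)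

⟦_⟧ : Bool → ℕ
⟦ true ⟧ = 1
⟦ false ⟧ = 0

count-cons : ∀ {A : Set} (f : A → Bool) x xs → count f (x ∷ xs) ≡ ⟦ f x ⟧ + count f xs
count-cons f x xs with f x
... | true = refl
... | false = refl

count-cong : ∀ {A : Set} {f g : A → Bool} → (∀ x → f x ≡ g x) → ∀ xs → count f xs ≡ count g xs
count-cong {f = f} {g} f≗g xs =
  cong length (filter-≐ (T? ∘ f) (T? ∘ g) ((λ {x} → subst T (f≗g x)) , (λ {x} → subst T (≡.sym (f≗g x)))) xs)

count-balance : ∀ {A : Set} (f g h k : A → Bool) → (∀ x → ⟦ f x ⟧ + ⟦ g x ⟧ ≡ ⟦ h x ⟧ + ⟦ k x ⟧) →
                ∀ xs → count f xs + count g xs ≡ count h xs + count k xs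
count-balance f g h k balance [] = refl
count-balance f g h k balance (x ∷ xs) = begin
  count f (x ∷ xs) + count g (x ∷ xs)             ≡⟨ cong₂ _+_ (count-cons f x xs) (count-cons g x xs) ⟩
  (⟦ f x ⟧ + count f xs) + (⟦ g x ⟧ + count g xs) ≡⟨ interchange ⟦ f x ⟧ (count f xs) ⟦ g x ⟧ (count g xs) ⟩
  (⟦ f x ⟧ + ⟦ g x ⟧) + (count f xs + count g xs) ≡⟨ cong₂ _+_ (balance x) (count-balance f g h k balance xs) ⟩
  (⟦ h x ⟧ + ⟦ k x ⟧) + (count h xs + count k xs) ≡⟨ interchange ⟦ h x ⟧ ⟦ k x ⟧ (count h xs) (count k xs) ⟩
  (⟦ h x ⟧ + count h xs) + (⟦ k x ⟧ + count k xs) ≡⟨ ≡.sym (cong₂ _+_ (count-cons h x xs) (count-cons k x xs)) ⟩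
  count h (x ∷ xs) + count k (x ∷ xs)             ∎
  where open ≡-Reasoning

count-absent : ∀ {n} {d : Fin n} {xs : List (Fin n)} → All (d ≢_) xs → count (_== d) xs ≡ 0
count-absent [] = refl
count-absent {d = d} {x ∷ xs} (d≢x ∷ d≢xs) =
  trans (count-cons (_== d) x xs) (cong₂ _+_ (cong ⟦_⟧ (==-≢ (≢-sym d≢x))) (count-absent d≢xs))

count-member : ∀ {n} {d : Fin n} {xs : List (Fin n)} → Unique xs → d ∈ xs → count (_== d) xs ≡ 1
count-member {d = d} {x ∷ xs} (x≢xs ∷ _) (here refl) =
  trans (count-cons (_== d) x xs) (cong₂ _+_ (cong ⟦_⟧ (==-≡ refl)) (count-absent x≢xs))
count-member {d = d} {x ∷ xs} (x≢xs ∷ unique) (there d∈xs) =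
  trans (count-cons (_== d) x xs) (cong₂ _+_ (cong ⟦_⟧ (==-≢ (All.lookup x≢xs d∈xs))) (count-member unique d∈xs))

-- The predicate f with its value at d switched off and its value at e
-- switched on: one row of an adjacency matrix after a 2-switch.
exchange : ∀ {n} → (Fin n → Bool) → Fin n → Fin n → Fin n → Bool
exchange f d e b = (f b ∧ not (b == d)) ∨ (b == e)

exchange-balance : ∀ {n} {f : Fin n → Bool} {d e : Fin n} → f d ≡ true → f e ≡ false → d ≢ e →
                   ∀ b → ⟦ exchange f d e b ⟧ + ⟦ b == d ⟧ ≡ ⟦ f b ⟧ + ⟦ b == e ⟧
exchange-balance {f = f} {d} {e} fd fe d≢e b with b ≟ d | b ≟ e
... | yes refl | yes refl = ⊥-elim (d≢e refl)
... | yes refl | no _ rewrite fd = refl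
... | no _ | yes refl rewrite fe = refl
... | no _ | no _ = cong (λ t → ⟦ t ⟧ + 0) (trans (∨-identityʳ (f b ∧ true)) (∧-identityʳ (f b)))

exchange-gain : ∀ {n} (f : Fin n → Bool) (d e : Fin n) → exchange f d e e ≡ true
exchange-gain f d e rewrite ==-≡ {a = e} refl = ∨-zeroʳ (f e ∧ not (e == d))

exchange-keep : ∀ {n} {f : Fin n → Bool} {d e b : Fin n} → f b ≡ true → b ≢ d → exchange f d e b ≡ true
exchange-keep fb b≢d rewrite fb | ==-≢ b≢d = refl

count-exchange : ∀ {n} {f : Fin n → Bool} {d e : Fin n} → f d ≡ true → f e ≡ false → d ≢ e →
                 count (exchange f d e) (allFin n) ≡ count f (allFin n)
count-exchange {n} {f} {d} {e} fd fe d≢e = +-cancelʳ-≡ 1 _ _ (begin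
  count (exchange f d e) (allFin n) + 1
    ≡⟨ cong (count (exchange f d e) (allFin n) +_) (≡.sym (occurs-once d)) ⟩
  count (exchange f d e) (allFin n) + count (_== d) (allFin n)
    ≡⟨ count-balance _ _ _ _ (exchange-balance fd fe d≢e) (allFin n) ⟩
  count f (allFin n) + count (_== e) (allFin n)             ≡⟨ cong (count f (allFin n) +_) (occurs-once e) ⟩
  count f (allFin n) + 1                                    ∎)
  where
  open ≡-Reasoning
  occurs-once : ∀ a → count (_== a) (allFin n) ≡ 1
  occurs-once a = count-member (allFin⁺ n) (∈-allFin a)

samePair-first : ∀ {n} {a b x y : Fin n} → a ≡ x → a ≢ y → samePair a b x y ≡ (b == y)
samePair-first a≡x a≢y rewrite ==-≡ a≡x | ==-≢ a≢y = ∨-identityʳ _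

samePair-second : ∀ {n} {a b x y : Fin n} → a ≢ x → a ≡ y → samePair a b x y ≡ (b == x)
samePair-second a≢x a≡y rewrite ==-≢ a≢x | ==-≡ a≡y = refl

samePair-neither : ∀ {n} {a b x y : Fin n} → a ≢ x → a ≢ y → samePair a b x y ≡ false
samePair-neither a≢x a≢y rewrite ==-≢ a≢x | ==-≢ a≢y = refl

samePair-swap : ∀ {n} (a b x y : Fin n) → samePair a b x y ≡ samePair b a x y
samePair-swap a b x y =
  trans (∨-comm ((a == x) ∧ (b == y)) ((a == y) ∧ (b == x)))
        (cong₂ _∨_ (∧-comm (a == y) (b == x)) (∧-comm (a == x) (b == y)))

samePair-loop : ∀ {n} (a : Fin n) {x y : Fin n} → x ≢ y → samePair a a x y ≡ false
samePair-loop a {x} {y} x≢y = by-cases (a ≟ x) (a ≟ y)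
  where
  by-cases : Dec (a ≡ x) → Dec (a ≡ y) → samePair a a x y ≡ false
  by-cases (yes refl) _ = trans (samePair-first refl x≢y) (==-≢ x≢y)
  by-cases (no a≢x) (yes refl) = trans (samePair-second a≢x refl) (==-≢ a≢x)
  by-cases (no a≢x) (no a≢y) = samePair-neither a≢x a≢y

module _ {n} (G : Cubic n) where

  edge-sym : ∀ {a b} → Edge G a b → Edge G b a
  edge-sym {a} {b} ab = trans (Cubic.sym G b a) ab

  nonEdge-sym : ∀ {a b} → NonEdge G a b → NonEdge G b a
  nonEdge-sym {a} {b} ab = trans (Cubic.sym G b a) ab

  edge-≢ : ∀ {a b} → Edge G a b → a ≢ b
  edge-≢ {a} ab refl with () ← trans (≡.sym ab) (irrefl G a)

  edge? : ∀ a b → Edge G a b ⊎ NonEdge G a b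
  edge? a b = decide (adj G a b) refl
    where
    decide : ∀ β → adj G a b ≡ β → Edge G a b ⊎ NonEdge G a b
    decide true ab = inj₁ ab
    decide false ab = inj₂ ab

  edge-nonEdge-≢ : ∀ {a b c} → Edge G a b → NonEdge G a c → b ≢ c
  edge-nonEdge-≢ ab ac refl with () ← trans (≡.sym ab) ac

-- A 2-switch: removing the edges pq, rs and adding the non-edges pr, qs keeps
-- a graph cubic. This is the common shape of make and break moves.
module Switch {n} (G : Cubic n) {p q r s : Fin n}
  (p≢q : p ≢ q) (p≢r : p ≢ r) (p≢s : p ≢ s) (q≢r : q ≢ r) (q≢s : q ≢ s) (r≢s : r ≢ s)
  (pq : Edge G p q) (rs : Edge G r s) (pr : NonEdge G p r) (qs : NonEdge G q s) where

  sw : Fin n → Fin n → Bool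
  sw = switched G p q r s p r q s

  row-p : ∀ b → sw p b ≡ exchange (adj G p) q r b
  row-p b rewrite samePair-first {b = b} refl p≢q | samePair-neither {b = b} p≢r p≢s
                | samePair-first {b = b} refl p≢r | samePair-neither {b = b} p≢q p≢s
    = cong₂ _∨_ (cong (adj G p b ∧_) (∧-identityʳ (not (b == q)))) (∨-identityʳ (b == r))

  row-q : ∀ b → sw q b ≡ exchange (adj G q) p s b
  row-q b rewrite samePair-second {b = b} (≢-sym p≢q) refl | samePair-neither {b = b} q≢r q≢s
                | samePair-neither {b = b} (≢-sym p≢q) q≢r | samePair-first {b = b} refl q≢s
    = cong (_∨ (b == s)) (cong (adj G q b ∧_) (∧-identityʳ (not (b == p))))

  row-r : ∀ b → sw r b ≡ exchange (adj G r) s p b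
  row-r b rewrite samePair-neither {b = b} (≢-sym p≢r) (≢-sym q≢r) | samePair-first {b = b} refl r≢s
                | samePair-second {b = b} (≢-sym p≢r) refl | samePair-neither {b = b} (≢-sym q≢r) r≢s
    = cong ((adj G r b ∧ not (b == s)) ∨_) (∨-identityʳ (b == p))

  row-s : ∀ b → sw s b ≡ exchange (adj G s) r q b
  row-s b rewrite samePair-neither {b = b} (≢-sym p≢s) (≢-sym q≢s) | samePair-second {b = b} (≢-sym r≢s) refl
                | samePair-neither {b = b} (≢-sym p≢s) (≢-sym r≢s) | samePair-second {b = b} (≢-sym q≢s) refl
    = refl

  row-other : ∀ a → a ≢ p → a ≢ q → a ≢ r → a ≢ s → ∀ b → sw a b ≡ adj G a b
  row-other a a≢p a≢q a≢r a≢s b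
    rewrite samePair-neither {b = b} a≢p a≢q | samePair-neither {b = b} a≢r a≢s
          | samePair-neither {b = b} a≢p a≢r | samePair-neither {b = b} a≢q a≢s
    = trans (∨-identityʳ (adj G a b ∧ true)) (∧-identityʳ (adj G a b))

  exchanged : ∀ {c d e} → (∀ b → sw c b ≡ exchange (adj G c) d e b) →
              Edge G c d → NonEdge G c e → d ≢ e → count (sw c) (allFin n) ≡ 3
  exchanged {c} row cd ce d≢e =
    trans (count-cong row (allFin n)) (trans (count-exchange cd ce d≢e) (deg3 G c))

  degree : ∀ a → count (sw a) (allFin n) ≡ 3
  degree a = by-cases (a ≟ p) (a ≟ q) (a ≟ r) (a ≟ s)
    where
    by-cases : Dec (a ≡ p) → Dec (a ≡ q) → Dec (a ≡ r) → Dec (a ≡ s) → count (sw a) (allFin n) ≡ 3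
    by-cases (yes refl) _ _ _ = exchanged row-p pq pr q≢r
    by-cases (no _) (yes refl) _ _ = exchanged row-q (edge-sym G pq) qs p≢s
    by-cases (no _) (no _) (yes refl) _ = exchanged row-r rs (nonEdge-sym G pr) (≢-sym p≢s)
    by-cases (no _) (no _) (no _) (yes refl) = exchanged row-s (edge-sym G rs) (nonEdge-sym G qs) (≢-sym q≢r)
    by-cases (no a≢p) (no a≢q) (no a≢r) (no a≢s) =
      trans (count-cong (row-other a a≢p a≢q a≢r a≢s) (allFin n)) (deg3 G a)

  sw-sym : ∀ a b → sw a b ≡ sw b a
  sw-sym a b rewrite Cubic.sym G a b | samePair-swap a b p q | samePair-swap a b r s
                   | samePair-swap a b p r | samePair-swap a b q s = refl

  sw-irrefl : ∀ a → sw a a ≡ false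
  sw-irrefl a rewrite irrefl G a | samePair-loop a p≢r | samePair-loop a q≢s = refl

  switch : Cubic n
  switch = record { adj = sw ; sym = sw-sym ; irrefl = sw-irrefl ; deg3 = degree }

module _ {n} (G : Cubic n) where

  neighbours : Fin n → List (Fin n)
  neighbours u = filterᵇ (adj G u) (allFin n)

  ∈-neighbours⁺ : ∀ {u t} → Edge G u t → t ∈ neighbours u
  ∈-neighbours⁺ {u} {t} ut = ∈-filter⁺ (T? ∘ adj G u) (∈-allFin t) (Equivalence.from T-≡ ut)

  ∈-neighbours⁻ : ∀ {u t} → t ∈ neighbours u → Edge G u t
  ∈-neighbours⁻ {u} t∈ = Equivalence.to T-≡ (proj₂ (∈-filter⁻ (T? ∘ adj G u) {xs = allFin n} t∈))

  neighbours-unique : ∀ u → Unique (neighbours u)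
  neighbours-unique u = filter⁺ (T? ∘ adj G u) (allFin⁺ n)

∈-─ : ∀ {A : Set} {x y : A} {ys : List A} (x∈ys : x ∈ ys) → y ∈ ys → y ≢ x → y ∈ ys ─ x∈ys
∈-─ (here refl) (here refl) y≢x = ⊥-elim (y≢x refl)
∈-─ (here refl) (there y∈ys) _ = y∈ys
∈-─ (there x∈ys) (here refl) _ = here refl
∈-─ (there x∈ys) (there y∈ys) y≢x = there (∈-─ x∈ys y∈ys y≢x)

unique-⊆-length : ∀ {A : Set} {xs ys : List A} → Unique xs → xs ⊆ ys → length xs ≤ length ys
unique-⊆-length {xs = []} _ _ = z≤n
unique-⊆-length {xs = x ∷ xs} {ys} (x≢xs ∷ unique) xs⊆ys =
  subst (suc (length xs) ≤_) (≡.sym (length-removeAt′ ys (index x∈ys)))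
        (s≤s (unique-⊆-length unique (λ y∈xs → ∈-─ x∈ys (xs⊆ys (there y∈xs)) (≢-sym (All.lookup x≢xs y∈xs)))))
  where
  x∈ys : x ∈ ys
  x∈ys = xs⊆ys (here refl)

noFourNeighbours : ∀ {n} (G : Cubic n) {u t₁ t₂ t₃ t₄ : Fin n} →
  Edge G u t₁ → Edge G u t₂ → Edge G u t₃ → Edge G u t₄ →
  t₁ ≢ t₂ → t₁ ≢ t₃ → t₁ ≢ t₄ → t₂ ≢ t₃ → t₂ ≢ t₄ → t₃ ≢ t₄ → ⊥
noFourNeighbours G {u} e₁ e₂ e₃ e₄ d₁₂ d₁₃ d₁₄ d₂₃ d₂₄ d₃₄ = four≰three (subst (4 ≤_) (deg3 G u) bound)
  where
  distinct : Unique (_ ∷ _ ∷ _ ∷ _ ∷ [])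
  distinct = (d₁₂ ∷ d₁₃ ∷ d₁₄ ∷ []) ∷ (d₂₃ ∷ d₂₄ ∷ []) ∷ (d₃₄ ∷ []) ∷ [] ∷ []
  bound = unique-⊆-length distinct (All.lookup (All.map (∈-neighbours⁺ G) (e₁ ∷ e₂ ∷ e₃ ∷ e₄ ∷ [])))
  four≰three : ¬ (4 ≤ 3)
  four≰three (s≤s (s≤s (s≤s ())))

record Neighbours3 {n} (G : Cubic n) (u : Fin n) : Set where
  constructor triple
  field
    first second third : Fin n
    u-first  : Edge G u first
    u-second : Edge G u second
    u-third  : Edge G u third
    first≢second : first ≢ second
    first≢third  : first ≢ third
    second≢third : second ≢ third

threeNeighbours : ∀ {n} (G : Cubic n) (u : Fin n) → Neighbours3 G u
threeNeighbours {n} G u = fromList (neighbours G u) (deg3 G u) (neighbours-unique G u) (∈-neighbours⁻ G)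
  where
  fromList : (L : List (Fin n)) → length L ≡ 3 → Unique L → (∀ {t} → t ∈ L → Edge G u t) → Neighbours3 G u
  fromList (a ∷ b ∷ c ∷ []) refl ((a≢b ∷ a≢c ∷ []) ∷ (b≢c ∷ []) ∷ [] ∷ []) edge =
    triple a b c (edge (here refl)) (edge (there (here refl))) (edge (there (there (here refl)))) a≢b a≢c b≢c

record Outer {n} (G : Cubic n) (x v : Fin n) : Set where
  constructor outer
  field
    o₁ o₂ : Fin n
    x-o₁ : Edge G x o₁
    x-o₂ : Edge G x o₂
    o₁≢o₂ : o₁ ≢ o₂
    o₁≢v : o₁ ≢ v
    o₂≢v : o₂ ≢ v
open Outer

swapOuter : ∀ {n} {G : Cubic n} {x v : Fin n} → Outer G x v → Outer G x v
swapOuter X = record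
  { o₁ = o₂ X ; o₂ = o₁ X ; x-o₁ = x-o₂ X ; x-o₂ = x-o₁ X
  ; o₁≢o₂ = ≢-sym (o₁≢o₂ X) ; o₁≢v = o₂≢v X ; o₂≢v = o₁≢v X }

outerNeighbours : ∀ {n} (G : Cubic n) {x v : Fin n} → Edge G x v → Outer G x v
outerNeighbours G {x} {v} xv with threeNeighbours G x
... | triple u₁ u₂ u₃ e₁ e₂ e₃ d₁₂ d₁₃ d₂₃ = by-cases (v ≟ u₁) (v ≟ u₂) (v ≟ u₃)
  where
  by-cases : Dec (v ≡ u₁) → Dec (v ≡ u₂) → Dec (v ≡ u₃) → Outer G x v
  by-cases (yes refl) _ _ = outer u₂ u₃ e₂ e₃ d₂₃ (≢-sym d₁₂) (≢-sym d₁₃)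
  by-cases (no _) (yes refl) _ = outer u₁ u₃ e₁ e₃ d₁₃ d₁₂ (≢-sym d₂₃)
  by-cases (no _) (no _) (yes refl) = outer u₁ u₂ e₁ e₂ d₁₂ d₁₃ d₂₃
  by-cases (no v≢u₁) (no v≢u₂) (no v≢u₃) =
    ⊥-elim (noFourNeighbours G e₁ e₂ e₃ xv d₁₂ d₁₃ (≢-sym v≢u₁) d₂₃ (≢-sym v≢u₂) (≢-sym v≢u₃))

avoiding : ∀ {n} {G : Cubic n} {x v : Fin n} → Outer G x v → (t : Fin n) →
           Σ (Fin n) (λ y → Edge G x y × y ≢ v × y ≢ t)
avoiding (outer o₁ o₂ x-o₁ x-o₂ o₁≢o₂ o₁≢v o₂≢v) t with o₁ ≟ t
... | yes refl = o₂ , x-o₂ , o₂≢v , ≢-sym o₁≢o₂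
... | no o₁≢t = o₁ , x-o₁ , o₁≢v , o₁≢t

record MakeData {n} (G : Cubic n) (v : Fin n) : Set where
  constructor makeData
  field
    x w y z : Fin n
    v-x : Edge G v x
    v-w : Edge G v w
    x≢w : x ≢ w
    x-y : Edge G x y
    y≢v : y ≢ v
    w-z : Edge G w z
    z≢v : z ≢ v
    y≢z : y ≢ z
    x-w : NonEdge G x w
    y-z : NonEdge G y z

-- The make move removes xy, wz and adds xw, yz; the new edge xw closes the
-- triangle v x w.
makeTriangle : ∀ {n} {G : Cubic n} {v : Fin n} → MakeData G v →
               Σ (Cubic n) (λ G' → MoveAdj G G' × InTriangle G' v)
makeTriangle {G = G} {v} (makeData x w y z v-x v-w x≢w x-y y≢v w-z z≢v y≢z x-w y-z) =
  switch ,
  inj₁ (y , x , v , w , z , distinct , edge-sym G x-y , edge-sym G v-x , v-w , w-z , x-w , y-z , λ _ _ → refl) ,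
  (x , w , v-x′ , x-w′ , w-v′)
  where
  x≢y : x ≢ y
  x≢y = edge-≢ G x-y
  y≢w : y ≢ w
  y≢w = edge-nonEdge-≢ G x-y x-w
  x≢z : x ≢ z
  x≢z = ≢-sym (edge-nonEdge-≢ G w-z (nonEdge-sym G x-w))
  v≢x : v ≢ x
  v≢x = edge-≢ G v-x
  v≢w : v ≢ w
  v≢w = edge-≢ G v-w
  w≢z : w ≢ z
  w≢z = edge-≢ G w-z
  distinct : Distinct5 y x v w z
  distinct = ≢-sym x≢y , y≢v , y≢w , y≢z , ≢-sym v≢x , x≢w , x≢z , v≢w , ≢-sym z≢v , w≢z
  open Switch G x≢y x≢w x≢z y≢w y≢z w≢z x-y w-z x-w y-z
  v-x′ : Edge switch v x
  v-x′ = trans (row-other v v≢x (≢-sym y≢v) v≢w (≢-sym z≢v) x) v-x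
  x-w′ : Edge switch x w
  x-w′ = trans (row-p w) (exchange-gain (adj G x) y w)
  w-v′ : Edge switch w v
  w-v′ = trans (row-r v) (exchange-keep {f = adj G w} {e = x} (edge-sym G v-w) (≢-sym z≢v))

module TriangleFree {n} (G : Cubic n) (v : Fin n) (no-triangle : ¬ InTriangle G v) where

  nbrs-nonadjacent : ∀ {p q} → Edge G v p → Edge G v q → NonEdge G p q
  nbrs-nonadjacent {p} {q} vp vq with edge? G p q
  ... | inj₁ pq = ⊥-elim (no-triangle (p , q , vp , pq , edge-sym G vq))
  ... | inj₂ pq = pq

  outer≢nbr : ∀ {p q t} → Edge G v p → Edge G v q → Edge G p t → t ≢ q
  outer≢nbr vp vq pt = edge-nonEdge-≢ G pt (nbrs-nonadjacent vp vq)

  attempt : ∀ {x w y z} → Edge G v x → Edge G v w → x ≢ w → Edge G x y → y ≢ v →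
            Edge G w z → z ≢ v → y ≢ z → MakeData G v ⊎ Edge G y z
  attempt {x} {w} {y} {z} vx vw x≢w xy y≢v wz z≢v y≢z with edge? G y z
  ... | inj₁ yz = inj₂ yz
  ... | inj₂ yz = inj₁ (makeData x w y z vx vw x≢w xy y≢v wz z≢v y≢z (nbrs-nonadjacent vx vw) yz)

  -- If s is adjacent to the neighbours x, y of v and to an outer neighbour t
  -- of x, then s has no further neighbours; so an outer neighbour z′ ≠ t of
  -- the third neighbour z of v is neither s nor adjacent to s.
  viaThird : ∀ {x y z s t z′} → Edge G v x → Edge G v y → Edge G v z → x ≢ y → x ≢ z → y ≢ z →
             Edge G x s → Edge G y s → Edge G x t → Edge G s t → s ≢ v →
             Edge G z z′ → z′ ≢ v → z′ ≢ t → MakeData G v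
  viaThird {s = s} {z′ = z′} vx vy vz x≢y x≢z y≢z xs ys xt st s≢v zz′ z′≢v z′≢t with s ≟ z′
  ... | yes refl =
    ⊥-elim (noFourNeighbours G (edge-sym G xs) (edge-sym G ys) st (edge-sym G zz′)
             x≢y (edge-≢ G xt) x≢z (≢-sym (outer≢nbr vx vy xt)) y≢z (outer≢nbr vx vz xt))
  ... | no s≢z′ with attempt vx vz x≢z xs s≢v zz′ z′≢v s≢z′
  ...   | inj₁ move = move
  ...   | inj₂ sz′ =
    ⊥-elim (noFourNeighbours G (edge-sym G xs) (edge-sym G ys) st sz′
             x≢y (edge-≢ G xt) (≢-sym (outer≢nbr vz vx zz′)) (≢-sym (outer≢nbr vx vy xt))
             (≢-sym (outer≢nbr vz vy zz′)) (≢-sym z′≢t))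

  sharedOuter : ∀ {x y z} → Edge G v x → Edge G v y → Edge G v z → x ≢ y → x ≢ z → y ≢ z →
                (X : Outer G x v) (Y : Outer G y v) → Outer G z v → o₁ X ≡ o₁ Y → MakeData G v
  sharedOuter vx vy vz x≢y x≢z y≢z (outer s t xs xt s≢t s≢v t≢v) (outer .s u ys yu s≢u _ u≢v) Z refl
    with attempt vx vy x≢y xt t≢v ys s≢v (≢-sym s≢t) | attempt vx vy x≢y xs s≢v yu u≢v s≢u
  ... | inj₁ move | _ = move
  ... | inj₂ _ | inj₁ move = move
  ... | inj₂ ts | inj₂ su with t ≟ u
  ...   | yes refl = let (z′ , zz′ , z′≢v , z′≢t) = avoiding Z t
                     in viaThird vx vy vz x≢y x≢z y≢z xs ys xt (edge-sym G ts) s≢v zz′ z′≢v z′≢t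
  ...   | no t≢u =
    ⊥-elim (noFourNeighbours G (edge-sym G xs) (edge-sym G ys) (edge-sym G ts) su
             x≢y (edge-≢ G xt) (≢-sym (outer≢nbr vy vx yu)) (≢-sym (outer≢nbr vx vy xt)) (edge-≢ G yu) t≢u)

  -- No sharing: the outer neighbour a₁ of a would be adjacent to a, b₁, b₂, c₁.
  unshared : ∀ {a b c} → Edge G v a → Edge G v b → Edge G v c → a ≢ b → a ≢ c →
             (A : Outer G a v) (B : Outer G b v) (C : Outer G c v) →
             o₁ A ≢ o₁ B → o₁ A ≢ o₂ B → o₁ A ≢ o₁ C → o₁ B ≢ o₁ C → o₂ B ≢ o₁ C → MakeData G v
  unshared va vb vc a≢b a≢c (outer a₁ _ aa₁ _ _ a₁≢v _) (outer b₁ b₂ bb₁ bb₂ b₁≢b₂ b₁≢v b₂≢v)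
           (outer c₁ _ cc₁ _ _ c₁≢v _) a₁≢b₁ a₁≢b₂ a₁≢c₁ b₁≢c₁ b₂≢c₁
    with attempt va vb a≢b aa₁ a₁≢v bb₁ b₁≢v a₁≢b₁ | attempt va vb a≢b aa₁ a₁≢v bb₂ b₂≢v a₁≢b₂
       | attempt va vc a≢c aa₁ a₁≢v cc₁ c₁≢v a₁≢c₁
  ... | inj₁ move | _ | _ = move
  ... | inj₂ _ | inj₁ move | _ = move
  ... | inj₂ _ | inj₂ _ | inj₁ move = move
  ... | inj₂ a₁b₁ | inj₂ a₁b₂ | inj₂ a₁c₁ =
    ⊥-elim (noFourNeighbours G (edge-sym G aa₁) a₁b₁ a₁b₂ a₁c₁
             (≢-sym (outer≢nbr vb va bb₁)) (≢-sym (outer≢nbr vb va bb₂)) (≢-sym (outer≢nbr vc va cc₁))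
             b₁≢b₂ b₁≢c₁ b₂≢c₁)

  makeMove : MakeData G v
  makeMove with threeNeighbours G v
  ... | triple a b c va vb vc a≢b a≢c b≢c =
    choose (outerNeighbours G (edge-sym G va)) (outerNeighbours G (edge-sym G vb)) (outerNeighbours G (edge-sym G vc))
    where
    choose : Outer G a v → Outer G b v → Outer G c v → MakeData G v
    choose A B C with o₁ A ≟ o₁ B | o₁ A ≟ o₂ B | o₁ A ≟ o₁ C | o₁ B ≟ o₁ C | o₂ B ≟ o₁ C
    ... | yes e | _ | _ | _ | _ = sharedOuter va vb vc a≢b a≢c b≢c A B C e
    ... | no _ | yes e | _ | _ | _ = sharedOuter va vb vc a≢b a≢c b≢c A (swapOuter B) C e
    ... | no _ | no _ | yes e | _ | _ = sharedOuter va vc vb a≢c a≢b (≢-sym b≢c) A C B e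
    ... | no _ | no _ | no _ | yes e | _ = sharedOuter vb vc va b≢c (≢-sym a≢b) (≢-sym a≢c) B C A e
    ... | no _ | no _ | no _ | no _ | yes e =
      sharedOuter vb vc va b≢c (≢-sym a≢b) (≢-sym a≢c) (swapOuter B) C A e
    ... | no d₁ | no d₂ | no d₃ | no d₄ | no d₅ = unshared va vb vc a≢b a≢c A B C d₁ d₂ d₃ d₄ d₅

lemma5 : (n : ℕ) → 4 ≤ n → 2 ∣ n → (G : Cubic n) → (v : Fin n) →
    ¬ InTriangle G v → Σ (Cubic n) (λ G' → MoveAdj G G' × InTriangle G' v)
lemma5 n _ _ G v no-triangle = makeTriangle (TriangleFree.makeMove G v no-triangle)
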